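{- Let $L/K$ be a finite Galois extension of fields with Galois group $G$, let $N$ be a $G$-stable regular subgroup of $\mathrm{Perm}(G)$, let $g\in G$ and $N_g=\rho(g)N\rho(g)^{ -1}$. Then an intermediate field $M$ of $L/K$ is realizable with respect to $L[N]^G$ if and only if the intermediate field $g(M)$ is realizable with respect to $L[N_g]^G$.
   Context: $\mathrm{Perm}(G)$ is the group of permutations of the set $G$; $\lambda(g)[h]=gh$, $\rho(g)[h]=hg^{ -1}$. A subgroup $N\le\mathrm{Perm}(G)$ is regular if it acts simply transitively on $G$, and $G$-stable if normalized by $\lambda(G)$; then $N_g$ is also $G$-stable regular. $G$ acts on $L[N]$ by $g\ast\sum_\eta c_\eta\eta=\sum_\eta g(c_\eta)\lambda(g)\eta\lambda(g)^{ -1}$, and the fixed ring $L[N]^G$ is a cocommutative $K$-Hopf algebra (with the Hopf structure inherited from the group algebra $L[N]$, counit $\varepsilon(\sum c_\eta\eta)=\sum c_\eta$) acting on $L$ by $\left(\sum_\eta c_\eta\eta\right)\cdot x=\sum_\eta c_\eta\,\eta^{ -1}[e_G](x)$; this gives a Hopf-Galois structure on $L/K$. For a Hopf subalgebra $H'$ of such a Hopf algebra $H$, its fixed field is $L^{H'}=\{x\in L : z\cdot x=\varepsilon(z)x \text{ for all } z\in H'\}$. An intermediate field $M$ is realizable with respect to $H$ if $M=L^{H'}$ for some Hopf subalgebra $H'$ of $H$. -}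

module Defs where

open import Level using (Level; _⊔_; suc)
open import Algebra.Bundles using (CommutativeRing)
open import Data.Nat using (ℕ)
open import Data.Fin using (Fin; _≟_)
open import Data.Fin.Properties using (all?)
import Data.List.Relation.Unary.All
open import Data.List using (List; []; _∷_; map; concatMap; _++_; foldr)
open import Data.Product using (Σ; ∃; _×_; _,_; proj₁; proj₂)
open import Function using (_∘_; id)
open import Relation.Nullary using (¬_; Dec; yes; no)
open import Relation.Unary using (Pred)
open import Relation.Binary.PropositionalEquality using (_≡_; refl; sym; trans; cong; module ≡-Reasoning)

record Field (c ℓ : Level) : Set (suc (c ⊔ ℓ)) where
  field
    commutativeRing : CommutativeRing c ℓ
  open CommutativeRing commutativeRing public
  field
    0≉1     : ¬ (0# ≈ 1#)
    inverse : ∀ x → ¬ (x ≈ 0#) → Σ Carrier λ y → (x * y) ≈ 1#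

record FinGroup : Set where
  field
    order : ℕ
    _·_   : Fin order → Fin order → Fin order
    e     : Fin order
    _⁻¹   : Fin order → Fin order
    assoc     : ∀ x y z → ((x · y) · z) ≡ (x · (y · z))
    identityˡ : ∀ x → (e · x) ≡ x
    identityʳ : ∀ x → (x · e) ≡ x
    inverseˡ  : ∀ x → ((x ⁻¹) · x) ≡ e
    inverseʳ  : ∀ x → (x · (x ⁻¹)) ≡ e
  infixl 7 _·_

-- A finite Galois extension L/K with Galois group G, presented as a
-- faithful action of the finite group G on the field L by field
-- automorphisms; K is the fixed field L^G (Artin's theorem: L/L^G is
-- finite Galois with group G, and every finite Galois extension arises
-- this way).

record GaloisAction {c ℓ : Level} (L : Field c ℓ) (G : FinGroup) : Set (c ⊔ ℓ) where
  open Field L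
  open FinGroup G
  field
    act      : Fin order → Carrier → Carrier
    act-cong : ∀ g {x y} → x ≈ y → act g x ≈ act g y
    act-+    : ∀ g x y → act g (x + y) ≈ (act g x + act g y)
    act-*    : ∀ g x y → act g (x * y) ≈ (act g x * act g y)
    act-1    : ∀ g → act g 1# ≈ 1#
    act-surj : ∀ g y → Σ Carrier λ x → act g x ≈ y
    act-hom  : ∀ g h x → act (g · h) x ≈ act g (act h x)
    act-e    : ∀ x → act e x ≈ x
    faithful : ∀ g → (∀ x → act g x ≈ x) → g ≡ e

module _ (G : FinGroup) where
  open FinGroup G

  record Perm : Set where
    field
      fun   : Fin order → Fin order
      inv   : Fin order → Fin order
      inv-r : ∀ x → fun (inv x) ≡ x
      inv-l : ∀ x → inv (fun x) ≡ x

  open Perm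

  _≐_ : Perm → Perm → Set
  π ≐ σ = ∀ x → fun π x ≡ fun σ x

  _≐?_ : (π σ : Perm) → Dec (π ≐ σ)
  π ≐? σ = all? (λ x → fun π x ≟ fun σ x)

  idPerm : Perm
  idPerm = record { fun = id ; inv = id ; inv-r = λ _ → refl ; inv-l = λ _ → refl }

  _∘P_ : Perm → Perm → Perm
  π ∘P σ = record
    { fun = fun π ∘ fun σ
    ; inv = inv σ ∘ inv π
    ; inv-r = λ x → trans (cong (fun π) (inv-r σ (inv π x))) (inv-r π x)
    ; inv-l = λ x → trans (cong (inv σ) (inv-l π (fun σ x))) (inv-l σ x) }

  _⁻¹P : Perm → Perm
  π ⁻¹P = record { fun = inv π ; inv = fun π ; inv-r = inv-l π ; inv-l = inv-r π }

  open ≡-Reasoning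
  cancelˡ : ∀ g x → (g · ((g ⁻¹) · x)) ≡ x
  cancelˡ g x = begin g · (g ⁻¹ · x) ≡⟨ sym (assoc g (g ⁻¹) x) ⟩ (g · g ⁻¹) · x
    ≡⟨ cong (_· x) (inverseʳ g) ⟩ e · x ≡⟨ identityˡ x ⟩ x ∎
  cancelˡ' : ∀ g x → ((g ⁻¹) · (g · x)) ≡ x
  cancelˡ' g x = begin g ⁻¹ · (g · x) ≡⟨ sym (assoc (g ⁻¹) g x) ⟩ (g ⁻¹ · g) · x
    ≡⟨ cong (_· x) (inverseˡ g) ⟩ e · x ≡⟨ identityˡ x ⟩ x ∎
  cancelʳ : ∀ g x → ((x · (g ⁻¹)) · g) ≡ x
  cancelʳ g x = begin (x · g ⁻¹) · g ≡⟨ assoc x (g ⁻¹) g ⟩ x · (g ⁻¹ · g)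
    ≡⟨ cong (x ·_) (inverseˡ g) ⟩ x · e ≡⟨ identityʳ x ⟩ x ∎
  cancelʳ' : ∀ g x → ((x · g) · (g ⁻¹)) ≡ x
  cancelʳ' g x = begin (x · g) · g ⁻¹ ≡⟨ assoc x g (g ⁻¹) ⟩ x · (g · g ⁻¹)
    ≡⟨ cong (x ·_) (inverseʳ g) ⟩ x · e ≡⟨ identityʳ x ⟩ x ∎

  -- λ(g) η λ(g)⁻¹ , where λ(g)[h] = g h :  h ↦ g · η[g⁻¹ · h]
  conjλ : Fin order → Perm → Perm
  conjλ g η = record
    { fun = λ h → g · fun η (g ⁻¹ · h)
    ; inv = λ h → g · inv η (g ⁻¹ · h)
    ; inv-r = λ h → trans (cong (λ u → g · fun η u) (cancelˡ' g (inv η (g ⁻¹ · h))))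
                     (trans (cong (g ·_) (inv-r η (g ⁻¹ · h))) (cancelˡ g h))
    ; inv-l = λ h → trans (cong (λ u → g · inv η u) (cancelˡ' g (fun η (g ⁻¹ · h))))
                     (trans (cong (g ·_) (inv-l η (g ⁻¹ · h))) (cancelˡ g h)) }

  -- ρ(g)⁻¹ π ρ(g) , where ρ(g)[h] = h g⁻¹ :  h ↦ π[h · g⁻¹] · g
  conjρ⁻¹ : Fin order → Perm → Perm
  conjρ⁻¹ g π = record
    { fun = λ h → fun π (h · g ⁻¹) · g
    ; inv = λ h → inv π (h · g ⁻¹) · g
    ; inv-r = λ h → trans (cong (λ u → fun π u · g) (cancelʳ' g (inv π (h · g ⁻¹))))
                     (trans (cong (_· g) (inv-r π (h · g ⁻¹))) (cancelʳ g h))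
    ; inv-l = λ h → trans (cong (λ u → inv π u · g) (cancelʳ' g (fun π (h · g ⁻¹))))
                     (trans (cong (_· g) (inv-l π (h · g ⁻¹))) (cancelʳ g h)) }

  -- N_g = ρ(g) N ρ(g)⁻¹ :  π ∈ N_g  iff  ρ(g)⁻¹ π ρ(g) ∈ N
  conjSub : ∀ {ℓN} → Fin order → Pred Perm ℓN → Pred Perm ℓN
  conjSub g N π = N (conjρ⁻¹ g π)

  record IsSubgroup {ℓN} (N : Pred Perm ℓN) : Set ℓN where
    field
      resp  : ∀ {π σ} → π ≐ σ → N π → N σ
      has-id : N idPerm
      ∘-closed : ∀ {π σ} → N π → N σ → N (π ∘P σ)
      ⁻¹-closed : ∀ {π} → N π → N (π ⁻¹P)

  record IsRegularSubgroup {ℓN} (N : Pred Perm ℓN) : Set ℓN where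
    field
      isSubgroup : IsSubgroup N
      transitive : ∀ x y → Σ Perm λ η → N η × (fun η x ≡ y)
      free       : ∀ x {η σ} → N η → N σ → fun η x ≡ fun σ x → η ≐ σ

  IsGStable : ∀ {ℓN} → Pred Perm ℓN → Set ℓN
  IsGStable N = ∀ g {η} → N η → N (conjλ g η)

-- Group algebras L[Perm(G)] (and L[Perm(G) × Perm(G)] ≅ L[Perm G] ⊗_L L[Perm G])
-- as formal L-linear combinations, compared coefficientwise.
-- L[N] is the subspace of combinations supported on N.

module Setup {c ℓ : Level} (L : Field c ℓ) (G : FinGroup) (A : GaloisAction L G) where
  open Field L
  open FinGroup G using (order; e)
  open GaloisAction A
  open Perm

  P : Set
  P = Perm G

  InK : Pred Carrier ℓ
  InK x = ∀ g → act g x ≈ x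

  record IsIntermediate {ℓM} (M : Pred Carrier ℓM) : Set (c ⊔ ℓ ⊔ ℓM) where
    field
      resp   : ∀ {x y} → x ≈ y → M x → M y
      K⊆M    : ∀ {x} → InK x → M x
      +-closed : ∀ {x y} → M x → M y → M (x + y)
      *-closed : ∀ {x y} → M x → M y → M (x * y)
      neg-closed : ∀ {x} → M x → M (- x)
      inv-closed : ∀ {x y} → M x → (x * y) ≈ 1# → M y

  image : ∀ {ℓM} → Fin order → Pred Carrier ℓM → Pred Carrier (c ⊔ ℓ ⊔ ℓM)
  image g M y = Σ Carrier λ x → M x × (y ≈ act g x)

  LP : Set c
  LP = List (Carrier × P)

  LP² : Set c
  LP² = List (Carrier × P × P)

  coeff : P → LP → Carrier
  coeff η [] = 0#
  coeff η ((a , σ) ∷ z) with _≐?_ G σ η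
  ... | yes _ = a + coeff η z
  ... | no _  = coeff η z

  coeff² : P → P → LP² → Carrier
  coeff² η η' [] = 0#
  coeff² η η' ((a , σ , σ') ∷ z) with _≐?_ G σ η | _≐?_ G σ' η'
  ... | yes _ | yes _ = a + coeff² η η' z
  ... | _     | _     = coeff² η η' z

  _≈LP_ : LP → LP → Set ℓ
  z ≈LP w = ∀ η → coeff η z ≈ coeff η w

  _≈LP²_ : LP² → LP² → Set ℓ
  z ≈LP² w = ∀ η η' → coeff² η η' z ≈ coeff² η η' w

  0LP : LP
  0LP = []

  1LP : LP
  1LP = (1# , idPerm G) ∷ []

  _+LP_ : LP → LP → LP
  _+LP_ = _++_

  _•_ : Carrier → LP → LP
  a • z = map (λ { (b , η) → (a * b , η) }) z

  _*LP_ : LP → LP → LP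
  z *LP w = concatMap (λ { (a , η) → map (λ { (b , σ) → (a * b , _∘P_ G η σ) }) w }) z

  Δ : LP → LP²
  Δ = map (λ { (a , η) → (a , η , η) })

  ε : LP → Carrier
  ε = foldr (λ { (a , _) r → a + r }) 0#

  S : LP → LP
  S = map (λ { (a , η) → (a , _⁻¹P G η) })

  _⊗_ : LP → LP → LP²
  z ⊗ w = concatMap (λ { (a , η) → map (λ { (b , σ) → (a * b , η , σ) }) w }) z

  sum² : List (LP × LP) → LP²
  sum² [] = []
  sum² ((x , y) ∷ r) = (x ⊗ y) ++ sum² r

  _⋆_ : Fin order → LP → LP
  g ⋆ z = map (λ { (a , η) → (act g a , conjλ G g η) }) z

  _▸_ : LP → Carrier → Carrier
  z ▸ x = foldr (λ { (a , η) r → (a * act (inv η e) x) + r }) 0# z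

  InLN : ∀ {ℓN} → Pred P ℓN → Pred LP (ℓ ⊔ ℓN)
  InLN N z = ∀ η → ¬ N η → coeff η z ≈ 0#

  InH : ∀ {ℓN} → Pred P ℓN → Pred LP (ℓ ⊔ ℓN)
  InH N z = InLN N z × (∀ g → (g ⋆ z) ≈LP z)

  record IsHopfSubalgebra {ℓN} (N : Pred P ℓN) (H' : Pred LP (c ⊔ ℓ)) : Set (c ⊔ ℓ ⊔ ℓN) where
    field
      resp      : ∀ {z w} → z ≈LP w → H' z → H' w
      ⊆H        : ∀ {z} → H' z → InH N z
      0-closed  : H' 0LP
      +-closed  : ∀ {z w} → H' z → H' w → H' (z +LP w)
      K•-closed : ∀ {a z} → InK a → H' z → H' (a • z)
      1-closed  : H' 1LP
      *-closed  : ∀ {z w} → H' z → H' w → H' (z *LP w)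
      Δ-closed  : ∀ {z} → H' z → Σ (List (LP × LP)) λ ts →
                    Data.List.Relation.Unary.All.All (λ t → H' (proj₁ t) × H' (proj₂ t)) ts
                    × (Δ z ≈LP² sum² ts)
      S-closed  : ∀ {z} → H' z → H' (S z)

  FixedField : Pred LP (c ⊔ ℓ) → Pred Carrier (c ⊔ ℓ)
  FixedField H' x = ∀ z → H' z → (z ▸ x) ≈ (ε z * x)

  Realizable : ∀ {ℓN ℓM} → Pred P ℓN → Pred Carrier ℓM → Set (suc (c ⊔ ℓ) ⊔ ℓN ⊔ ℓM)
  Realizable N M = Σ (Pred LP (c ⊔ ℓ)) λ H' → IsHopfSubalgebra N H'
                     × (∀ x → (M x → FixedField H' x) × (FixedField H' x → M x))

{-# OPTIONS --safe #-}
module Submission where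

-- Let ρ̂ be the relabelling π ↦ ρ(g)⁻¹ π ρ(g) of permutations. It is an automorphism of Perm(G)
-- commuting with conjugation by λ(G) and mapping N_g onto N, so applying it to the permutations of a
-- formal sum (keeping the coefficients) identifies L[N_g]^G with L[N]^G as Hopf algebras; hence the
-- preimage of a Hopf subalgebra H' is a Hopf subalgebra. On G-invariant z it intertwines the actions
-- on L with g, g(ρ̂(z)·x) = z·g(x), so the fixed field of the preimage is g(L^{H'}). The converse is
-- the same statement for g⁻¹, because (N_g)_{g⁻¹} = N and g⁻¹(g(M)) = M.

open import Defs
open import Level using (Level; _⊔_)
open import Algebra.Properties.AbelianGroup as AbelianGroupProperties using ()
open import Algebra.Properties.Group as GroupProperties using ()
open import Algebra.Properties.Ring as RingProperties using ()
open import Data.Empty using (⊥-elim)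
open import Data.Fin using (Fin)
open import Data.List using (List; []; _∷_; _++_; map; length)
open import Data.List.Properties using (map-++)
open import Data.List.Relation.Binary.Pointwise using (Pointwise; []; _∷_)
open import Data.List.Relation.Unary.All as All using (All)
open import Data.List.Relation.Unary.All.Properties using (map⁺)
open import Data.Nat using (suc; _≤_; z≤n; s≤s)
open import Data.Nat.Properties using (≤-refl; ≤-trans; n≤1+n)
open import Data.Product as Product using (Σ; _×_; _,_; proj₁; proj₂; map₁; map₂)
open import Function using (const; _∘_)
open import Function.Bundles using (_⇔_; mk⇔)
open import Relation.Binary.PropositionalEquality as ≡ using (_≡_)
open import Relation.Nullary using (¬_; yes; no)
open import Relation.Unary using (Pred; _⊆_)

module PermutationEquality (G : FinGroup) where
  open FinGroup G
  open Perm

  infix 4 _≅_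

  -- A record around the pointwise equality _≐_, so that both permutations
  -- can be inferred from an argument of this type.
  record _≅_ (π σ : Perm G) : Set where
    constructor mk≅
    field pointwise : _≐_ G π σ
  open _≅_ public

  ≅-refl : ∀ {π} → π ≅ π
  ≅-refl = mk≅ λ _ → ≡.refl

  ≅-sym : ∀ {π σ} → π ≅ σ → σ ≅ π
  ≅-sym (mk≅ p) = mk≅ λ x → ≡.sym (p x)

  ≅-trans : ∀ {π σ τ} → π ≅ σ → σ ≅ τ → π ≅ τ
  ≅-trans (mk≅ p) (mk≅ q) = mk≅ λ x → ≡.trans (p x) (q x)

  inv-cong : ∀ {π σ} → π ≅ σ → ∀ x → inv π x ≡ inv σ x
  inv-cong {π} {σ} (mk≅ p) x = begin
    inv π x                 ≡⟨ ≡.cong (inv π) (≡.sym (inv-r σ x)) ⟩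
    inv π (fun σ (inv σ x)) ≡⟨ ≡.cong (inv π) (≡.sym (p (inv σ x))) ⟩
    inv π (fun π (inv σ x)) ≡⟨ inv-l π (inv σ x) ⟩
    inv σ x                 ∎
    where open ≡.≡-Reasoning

  record IsλEquivariantAutomorphism (f : Perm G → Perm G) : Set where
    field
      inverse    : Perm G → Perm G
      cong       : ∀ {π σ} → π ≅ σ → f π ≅ f σ
      injective  : ∀ {π σ} → f π ≅ f σ → π ≅ σ
      inverseʳ   : ∀ π → f (inverse π) ≅ π
      ∘-homo     : ∀ π σ → f (_∘P_ G π σ) ≅ _∘P_ G (f π) (f σ)
      id-homo    : f (idPerm G) ≅ idPerm G
      ⁻¹-homo    : ∀ π → f (_⁻¹P G π) ≅ _⁻¹P G (f π)
      conjλ-comm : ∀ k π → f (conjλ G k π) ≅ conjλ G k (f π)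

  conjρ⁻¹-cong : ∀ g {π σ} → π ≅ σ → conjρ⁻¹ G g π ≅ conjρ⁻¹ G g σ
  conjρ⁻¹-cong g (mk≅ p) = mk≅ λ h → ≡.cong (_· g) (p (h · g ⁻¹))

  conjρ⁻¹-inverseʳ : ∀ g π → conjρ⁻¹ G g (conjρ⁻¹ G (g ⁻¹) π) ≅ π
  conjρ⁻¹-inverseʳ g π = mk≅ λ h →
    ≡.trans (≡.cong (λ u → (fun π u · g ⁻¹) · g) (cancelʳ' G (g ⁻¹) h)) (cancelʳ G g (fun π h))

  conjρ⁻¹-inverseˡ : ∀ g π → conjρ⁻¹ G (g ⁻¹) (conjρ⁻¹ G g π) ≅ π
  conjρ⁻¹-inverseˡ g π = mk≅ λ h →
    ≡.trans (≡.cong (λ u → (fun π u · g) · g ⁻¹) (cancelʳ G (g ⁻¹) h)) (cancelʳ' G g (fun π h))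

  conjρ⁻¹-isλEquivariantAutomorphism : ∀ g → IsλEquivariantAutomorphism (conjρ⁻¹ G g)
  conjρ⁻¹-isλEquivariantAutomorphism g = record
    { inverse    = conjρ⁻¹ G (g ⁻¹)
    ; cong       = conjρ⁻¹-cong g
    ; injective  = λ {π} {σ} p → ≅-trans (≅-sym (conjρ⁻¹-inverseˡ g π))
                     (≅-trans (conjρ⁻¹-cong (g ⁻¹) p) (conjρ⁻¹-inverseˡ g σ))
    ; inverseʳ   = conjρ⁻¹-inverseʳ g
    ; ∘-homo     = λ π σ → mk≅ λ h →
                     ≡.cong (λ u → fun π u · g) (≡.sym (cancelʳ' G g (fun σ (h · g ⁻¹))))
    ; id-homo    = mk≅ (cancelʳ G g)
    ; ⁻¹-homo    = λ _ → ≅-refl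
    ; conjλ-comm = λ k π → mk≅ λ h →
                     ≡.trans (≡.cong (λ u → (k · fun π u) · g) (≡.sym (assoc (k ⁻¹) h (g ⁻¹))))
                             (assoc k _ g)
    }

module FormalSums {c ℓ} (L : Field c ℓ) (G : FinGroup) (A : GaloisAction L G) where
  open Field L
  open FinGroup G using (e)
  open GaloisAction A
  open Setup L G A
  open PermutationEquality G
  open Perm
  open RingProperties ring using (-‿distribˡ-*)
  open AbelianGroupProperties +-abelianGroup using (⁻¹-∙-comm)
  open GroupProperties +-group using (x∙y⁻¹≈ε⇒x≈y; ε⁻¹≈ε)
  open import Relation.Binary.Reasoning.Setoid setoid

  coeff-here : ∀ {a σ η} z → σ ≅ η → coeff η ((a , σ) ∷ z) ≡ a + coeff η z
  coeff-here {σ = σ} {η} z p with _≐?_ G σ η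
  ... | yes _ = ≡.refl
  ... | no ¬p = ⊥-elim (¬p (pointwise p))

  coeff-there : ∀ {a σ η} z → ¬ σ ≅ η → coeff η ((a , σ) ∷ z) ≡ coeff η z
  coeff-there {σ = σ} {η} z ¬p with _≐?_ G σ η
  ... | yes p = ⊥-elim (¬p (mk≅ p))
  ... | no _  = ≡.refl

  coeff-cong : ∀ {η η'} z → η ≅ η' → coeff η z ≡ coeff η' z
  coeff-cong [] p = ≡.refl
  coeff-cong {η} ((a , σ) ∷ z) p with _≐?_ G σ η
  ... | yes q = ≡.trans (≡.cong (a +_) (coeff-cong z p)) (≡.sym (coeff-here z (≅-trans (mk≅ q) p)))
  ... | no ¬q = ≡.trans (coeff-cong z p) (≡.sym (coeff-there z λ r → ¬q (pointwise (≅-trans r (≅-sym p)))))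

  coeff-++ : ∀ η z w → coeff η (z ++ w) ≈ coeff η z + coeff η w
  coeff-++ η [] w = sym (+-identityˡ _)
  coeff-++ η ((a , σ) ∷ z) w with _≐?_ G σ η
  ... | yes _ = trans (+-cong refl (coeff-++ η z w)) (sym (+-assoc _ _ _))
  ... | no _  = coeff-++ η z w

  negate : LP → LP
  negate = map (map₁ (-_))

  coeff-negate : ∀ η z → coeff η (negate z) ≈ - coeff η z
  coeff-negate η [] = sym ε⁻¹≈ε
  coeff-negate η ((a , σ) ∷ z) with _≐?_ G σ η
  ... | yes _ = trans (+-cong refl (coeff-negate η z)) (⁻¹-∙-comm _ _)
  ... | no _  = coeff-negate η z

  dropTerms : P → LP → LP
  dropTerms η [] = []
  dropTerms η ((a , σ) ∷ z) with _≐?_ G σ η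
  ... | yes _ = dropTerms η z
  ... | no _  = (a , σ) ∷ dropTerms η z

  length-dropTerms : ∀ η z → length (dropTerms η z) ≤ length z
  length-dropTerms η [] = z≤n
  length-dropTerms η ((a , σ) ∷ z) with _≐?_ G σ η
  ... | yes _ = ≤-trans (length-dropTerms η z) (n≤1+n _)
  ... | no _  = s≤s (length-dropTerms η z)

  length-dropTerms-head : ∀ a η z → length (dropTerms η ((a , η) ∷ z)) ≤ length z
  length-dropTerms-head a η z with _≐?_ G η η
  ... | yes _ = length-dropTerms η z
  ... | no ¬p = ⊥-elim (¬p λ _ → ≡.refl)

  coeff-dropTerms-≅ : ∀ {σ η} z → σ ≅ η → coeff σ (dropTerms η z) ≈ 0#
  coeff-dropTerms-≅ [] p = refl
  coeff-dropTerms-≅ {σ} {η} ((a , τ) ∷ z) p with _≐?_ G τ η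
  ... | yes _ = coeff-dropTerms-≅ z p
  ... | no ¬q = trans (reflexive (coeff-there (dropTerms η z) λ r → ¬q (pointwise (≅-trans r p))))
                      (coeff-dropTerms-≅ z p)

  coeff-dropTerms-≇ : ∀ {σ η} z → ¬ σ ≅ η → coeff σ (dropTerms η z) ≈ coeff σ z
  coeff-dropTerms-≇ [] ¬p = refl
  coeff-dropTerms-≇ {σ} {η} ((a , τ) ∷ z) ¬p with _≐?_ G τ η
  ... | yes q = trans (coeff-dropTerms-≇ z ¬p)
                      (reflexive (≡.sym (coeff-there z λ r → ¬p (≅-trans (≅-sym r) (mk≅ q)))))
  ... | no _ with _≐?_ G τ σ
  ...   | yes _ = +-cong refl (coeff-dropTerms-≇ z ¬p)
  ...   | no _  = coeff-dropTerms-≇ z ¬p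

  linearExt : (P → Carrier) → LP → Carrier
  linearExt h [] = 0#
  linearExt h ((a , η) ∷ z) = a * h η + linearExt h z

  module _ (h : P → Carrier) (h-cong : ∀ {σ η} → σ ≅ η → h σ ≈ h η) where

    linearExt-dropTerms : ∀ η z → linearExt h z ≈ coeff η z * h η + linearExt h (dropTerms η z)
    linearExt-dropTerms η [] = sym (trans (+-identityʳ _) (zeroˡ _))
    linearExt-dropTerms η ((a , σ) ∷ z) with _≐?_ G σ η
    ... | yes q = begin
      a * h σ + linearExt h z                                  ≈⟨ +-cong (*-cong refl (h-cong (mk≅ q))) (linearExt-dropTerms η z) ⟩
      a * h η + (coeff η z * h η + linearExt h (dropTerms η z)) ≈⟨ sym (+-assoc _ _ _) ⟩
      (a * h η + coeff η z * h η) + linearExt h (dropTerms η z) ≈⟨ +-cong (sym (distribʳ _ _ _)) refl ⟩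
      (a + coeff η z) * h η + linearExt h (dropTerms η z)       ∎
    ... | no _ = begin
      a * h σ + linearExt h z                                  ≈⟨ +-cong refl (linearExt-dropTerms η z) ⟩
      a * h σ + (coeff η z * h η + linearExt h (dropTerms η z)) ≈⟨ sym (+-assoc _ _ _) ⟩
      (a * h σ + coeff η z * h η) + linearExt h (dropTerms η z) ≈⟨ +-cong (+-comm _ _) refl ⟩
      (coeff η z * h η + a * h σ) + linearExt h (dropTerms η z) ≈⟨ +-assoc _ _ _ ⟩
      coeff η z * h η + (a * h σ + linearExt h (dropTerms η z)) ∎

    linearExt-zero : ∀ n z → length z ≤ n → z ≈LP [] → linearExt h z ≈ 0#
    linearExt-zero n [] _ _ = refl
    linearExt-zero (suc n) z@((a , η) ∷ z') (s≤s |z'|≤n) z≈0 = begin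
      linearExt h z                                  ≈⟨ linearExt-dropTerms η z ⟩
      coeff η z * h η + linearExt h (dropTerms η z)  ≈⟨ +-cong (*-cong (z≈0 η) refl) rest≈0 ⟩
      0# * h η + 0#                                  ≈⟨ trans (+-identityʳ _) (zeroˡ _) ⟩
      0#                                             ∎
      where
      dropped≈0 : dropTerms η z ≈LP []
      dropped≈0 σ with _≐?_ G σ η
      ... | yes p = coeff-dropTerms-≅ z (mk≅ p)
      ... | no ¬p = trans (coeff-dropTerms-≇ z λ r → ¬p (pointwise r)) (z≈0 σ)
      rest≈0 : linearExt h (dropTerms η z) ≈ 0#
      rest≈0 = linearExt-zero n (dropTerms η z) (≤-trans (length-dropTerms-head a η z') |z'|≤n) dropped≈0

    linearExt-++ : ∀ z w → linearExt h (z ++ w) ≈ linearExt h z + linearExt h w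
    linearExt-++ [] w = sym (+-identityˡ _)
    linearExt-++ ((a , σ) ∷ z) w = trans (+-cong refl (linearExt-++ z w)) (sym (+-assoc _ _ _))

    linearExt-negate : ∀ z → linearExt h (negate z) ≈ - linearExt h z
    linearExt-negate [] = sym ε⁻¹≈ε
    linearExt-negate ((a , σ) ∷ z) =
      trans (+-cong (sym (-‿distribˡ-* _ _)) (linearExt-negate z)) (⁻¹-∙-comm _ _)

    linearExt-resp : ∀ z w → z ≈LP w → linearExt h z ≈ linearExt h w
    linearExt-resp z w z≈w = x∙y⁻¹≈ε⇒x≈y _ _ (begin
      linearExt h z - linearExt h w           ≈⟨ +-cong refl (linearExt-negate w) ⟨
      linearExt h z + linearExt h (negate w)  ≈⟨ linearExt-++ z (negate w) ⟨
      linearExt h (z ++ negate w)             ≈⟨ linearExt-zero _ (z ++ negate w) ≤-refl difference≈0 ⟩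
      0#                                      ∎)
      where
      difference≈0 : (z ++ negate w) ≈LP []
      difference≈0 η = begin
        coeff η (z ++ negate w)          ≈⟨ coeff-++ η z (negate w) ⟩
        coeff η z + coeff η (negate w)   ≈⟨ +-cong (z≈w η) (coeff-negate η w) ⟩
        coeff η w - coeff η w            ≈⟨ -‿inverseʳ _ ⟩
        0#                               ∎

  ▸-linearExt : ∀ z x → (z ▸ x) ≡ linearExt (λ η → act (inv η e) x) z
  ▸-linearExt [] x = ≡.refl
  ▸-linearExt ((a , η) ∷ z) x = ≡.cong (a * act (inv η e) x +_) (▸-linearExt z x)

  ▸-resp : ∀ z w x → z ≈LP w → (z ▸ x) ≈ (w ▸ x)
  ▸-resp z w x z≈w = begin
    z ▸ x                                     ≡⟨ ▸-linearExt z x ⟩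
    linearExt (λ η → act (inv η e) x) z       ≈⟨ linearExt-resp _ evaluation-cong z w z≈w ⟩
    linearExt (λ η → act (inv η e) x) w       ≡⟨ ≡.sym (▸-linearExt w x) ⟩
    w ▸ x                                     ∎
    where
    evaluation-cong : ∀ {σ η} → σ ≅ η → act (inv σ e) x ≈ act (inv η e) x
    evaluation-cong p = reflexive (≡.cong (λ k → act k x) (inv-cong p e))

  ▸-cong : ∀ z {x y} → x ≈ y → (z ▸ x) ≈ (z ▸ y)
  ▸-cong [] _ = refl
  ▸-cong ((a , η) ∷ z) x≈y = +-cong (*-cong refl (act-cong _ x≈y)) (▸-cong z x≈y)

  ε-linearExt : ∀ z → ε z ≈ linearExt (const 1#) z
  ε-linearExt [] = refl
  ε-linearExt ((a , η) ∷ z) = +-cong (sym (*-identityʳ a)) (ε-linearExt z)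

  ε-resp : ∀ z w → z ≈LP w → ε z ≈ ε w
  ε-resp z w z≈w = begin
    ε z                         ≈⟨ ε-linearExt z ⟩
    linearExt (const 1#) z      ≈⟨ linearExt-resp _ (const refl) z w z≈w ⟩
    linearExt (const 1#) w      ≈⟨ sym (ε-linearExt w) ⟩
    ε w                         ∎

  infix 4 _∼_ _≋_ _∼²_ _≋²_

  _∼_ : Carrier × P → Carrier × P → Set ℓ
  (a , σ) ∼ (b , τ) = a ≈ b × σ ≅ τ

  _≋_ : LP → LP → Set (c ⊔ ℓ)
  _≋_ = Pointwise _∼_

  _∼²_ : Carrier × P × P → Carrier × P × P → Set ℓ
  (a , σ , σ') ∼² (b , τ , τ') = a ≈ b × σ ≅ τ × σ' ≅ τ'

  _≋²_ : LP² → LP² → Set (c ⊔ ℓ)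
  _≋²_ = Pointwise _∼²_

  ≋⇒≈LP : ∀ {z w} → z ≋ w → z ≈LP w
  ≋⇒≈LP [] η = refl
  ≋⇒≈LP {(a , σ) ∷ z} {(b , τ) ∷ w} ((a≈b , σ≅τ) ∷ z≋w) η with _≐?_ G σ η
  ... | yes p = trans (+-cong a≈b (≋⇒≈LP z≋w η))
                      (reflexive (≡.sym (coeff-here w (≅-trans (≅-sym σ≅τ) (mk≅ p)))))
  ... | no ¬p = trans (≋⇒≈LP z≋w η)
                      (reflexive (≡.sym (coeff-there w λ r → ¬p (pointwise (≅-trans σ≅τ r)))))

  ≋⇒≈LP-sym : ∀ {z w} → z ≋ w → w ≈LP z
  ≋⇒≈LP-sym z≋w η = sym (≋⇒≈LP z≋w η)

  coeff²-here : ∀ {a σ σ' η η'} z → σ ≅ η → σ' ≅ η' →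
                coeff² η η' ((a , σ , σ') ∷ z) ≡ a + coeff² η η' z
  coeff²-here {σ = σ} {σ'} {η} {η'} z p p' with _≐?_ G σ η | _≐?_ G σ' η'
  ... | yes _ | yes _  = ≡.refl
  ... | no ¬p | _      = ⊥-elim (¬p (pointwise p))
  ... | yes _ | no ¬p' = ⊥-elim (¬p' (pointwise p'))

  coeff²-there : ∀ {a σ σ' η η'} z → ¬ (σ ≅ η × σ' ≅ η') →
                 coeff² η η' ((a , σ , σ') ∷ z) ≡ coeff² η η' z
  coeff²-there {σ = σ} {σ'} {η} {η'} z ¬p with _≐?_ G σ η | _≐?_ G σ' η'
  ... | yes p | yes p' = ⊥-elim (¬p (mk≅ p , mk≅ p'))
  ... | no _  | _      = ≡.refl
  ... | yes _ | no _   = ≡.refl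

  ≋²⇒≈LP² : ∀ {z w} → z ≋² w → z ≈LP² w
  ≋²⇒≈LP² [] η η' = refl
  ≋²⇒≈LP² {(a , σ , σ') ∷ z} {(b , τ , τ') ∷ w} ((a≈b , σ≅τ , σ'≅τ') ∷ z≋w) η η'
    with _≐?_ G σ η | _≐?_ G σ' η'
  ... | yes p | yes p' = trans (+-cong a≈b (≋²⇒≈LP² z≋w η η'))
                               (reflexive (≡.sym (coeff²-here w (≅-trans (≅-sym σ≅τ) (mk≅ p))
                                                                (≅-trans (≅-sym σ'≅τ') (mk≅ p')))))
  ... | no ¬p | _      = trans (≋²⇒≈LP² z≋w η η')
                               (reflexive (≡.sym (coeff²-there w λ (r , _) → ¬p (pointwise (≅-trans σ≅τ r)))))
  ... | yes _ | no ¬p' = trans (≋²⇒≈LP² z≋w η η')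
                               (reflexive (≡.sym (coeff²-there w λ (_ , r) → ¬p' (pointwise (≅-trans σ'≅τ' r)))))

  relabel : (P → P) → LP → LP
  relabel f = map (map₂ f)

  relabel² : (P → P) → LP² → LP²
  relabel² f = map (map₂ (Product.map f f))

  ε-relabel : ∀ f z → ε (relabel f z) ≡ ε z
  ε-relabel f [] = ≡.refl
  ε-relabel f ((a , η) ∷ z) = ≡.cong (a +_) (ε-relabel f z)

module Relabelling {c ℓ} (L : Field c ℓ) (G : FinGroup) (A : GaloisAction L G)
                   {f : Perm G → Perm G} (f-aut : PermutationEquality.IsλEquivariantAutomorphism G f) where
  open Field L
  open Setup L G A
  open PermutationEquality G
  open IsλEquivariantAutomorphism f-aut renaming (inverse to f⁻¹)
  open FormalSums L G A
  open import Relation.Binary.Reasoning.Setoid setoid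

  coeff-relabel : ∀ η z → coeff (f η) (relabel f z) ≡ coeff η z
  coeff-relabel η [] = ≡.refl
  coeff-relabel η ((a , σ) ∷ z) with _≐?_ G σ η
  ... | yes p = ≡.trans (coeff-here (relabel f z) (cong (mk≅ p))) (≡.cong (a +_) (coeff-relabel η z))
  ... | no ¬p = ≡.trans (coeff-there (relabel f z) λ r → ¬p (pointwise (injective r))) (coeff-relabel η z)

  coeff-relabel⁻¹ : ∀ η z → coeff η (relabel f z) ≡ coeff (f⁻¹ η) z
  coeff-relabel⁻¹ η z = ≡.trans (coeff-cong (relabel f z) (≅-sym (inverseʳ η))) (coeff-relabel (f⁻¹ η) z)

  coeff²-relabel : ∀ η η' z → coeff² (f η) (f η') (relabel² f z) ≡ coeff² η η' z
  coeff²-relabel η η' [] = ≡.refl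
  coeff²-relabel η η' ((a , σ , σ') ∷ z) with _≐?_ G σ η | _≐?_ G σ' η'
  ... | yes p | yes p' = ≡.trans (coeff²-here (relabel² f z) (cong (mk≅ p)) (cong (mk≅ p')))
                                 (≡.cong (a +_) (coeff²-relabel η η' z))
  ... | no ¬p | _      = ≡.trans (coeff²-there (relabel² f z) λ (r , _) → ¬p (pointwise (injective r)))
                                 (coeff²-relabel η η' z)
  ... | yes _ | no ¬p' = ≡.trans (coeff²-there (relabel² f z) λ (_ , r) → ¬p' (pointwise (injective r)))
                                 (coeff²-relabel η η' z)

  relabel-resp : ∀ z w → z ≈LP w → relabel f z ≈LP relabel f w
  relabel-resp z w z≈w η = begin
    coeff η (relabel f z) ≡⟨ coeff-relabel⁻¹ η z ⟩
    coeff (f⁻¹ η) z       ≈⟨ z≈w (f⁻¹ η) ⟩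
    coeff (f⁻¹ η) w       ≡⟨ coeff-relabel⁻¹ η w ⟨
    coeff η (relabel f w) ∎

  relabel-inverse : ∀ z → relabel f (relabel f⁻¹ z) ≋ z
  relabel-inverse [] = []
  relabel-inverse ((a , η) ∷ z) = (refl , inverseʳ η) ∷ relabel-inverse z

  relabel-⋆ : ∀ k z → relabel f (k ⋆ z) ≋ k ⋆ relabel f z
  relabel-⋆ k [] = []
  relabel-⋆ k ((a , η) ∷ z) = (refl , conjλ-comm k η) ∷ relabel-⋆ k z

  relabel-• : ∀ a z → relabel f (a • z) ≡ a • relabel f z
  relabel-• a [] = ≡.refl
  relabel-• a ((b , η) ∷ z) = ≡.cong ((a * b , f η) ∷_) (relabel-• a z)

  relabel-S : ∀ z → relabel f (S z) ≋ S (relabel f z)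
  relabel-S [] = []
  relabel-S ((a , η) ∷ z) = (refl , ⁻¹-homo η) ∷ relabel-S z

  relabel²-Δ : ∀ z → relabel² f (Δ z) ≡ Δ (relabel f z)
  relabel²-Δ [] = ≡.refl
  relabel²-Δ ((a , η) ∷ z) = ≡.cong ((a , f η , f η) ∷_) (relabel²-Δ z)

  relabel-++⁺ : ∀ xs {ys xs' ys'} → relabel f xs ≋ xs' → relabel f ys ≋ ys' →
                relabel f (xs ++ ys) ≋ xs' ++ ys'
  relabel-++⁺ [] [] q = q
  relabel-++⁺ (_ ∷ xs) (p ∷ ps) q = p ∷ relabel-++⁺ xs ps q

  relabel²-++⁺ : ∀ xs {ys xs' ys'} → relabel² f xs ≋² xs' → relabel² f ys ≋² ys' →
                 relabel² f (xs ++ ys) ≋² xs' ++ ys'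
  relabel²-++⁺ [] [] q = q
  relabel²-++⁺ (_ ∷ xs) (p ∷ ps) q = p ∷ relabel²-++⁺ xs ps q

  relabel-map : ∀ (F₁ F₂ : Carrier × P → Carrier × P) → (∀ b σ → map₂ f (F₁ (b , σ)) ∼ F₂ (b , f σ)) →
                ∀ w → relabel f (map F₁ w) ≋ map F₂ (relabel f w)
  relabel-map F₁ F₂ F₁∼F₂ [] = []
  relabel-map F₁ F₂ F₁∼F₂ ((b , σ) ∷ w) = F₁∼F₂ b σ ∷ relabel-map F₁ F₂ F₁∼F₂ w

  relabel²-map : ∀ (F₁ F₂ : Carrier × P → Carrier × P × P) →
                 (∀ b σ → map₂ (Product.map f f) (F₁ (b , f⁻¹ σ)) ∼² F₂ (b , σ)) →
                 ∀ w → relabel² f (map F₁ (relabel f⁻¹ w)) ≋² map F₂ w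
  relabel²-map F₁ F₂ F₁∼F₂ [] = []
  relabel²-map F₁ F₂ F₁∼F₂ ((b , σ) ∷ w) = F₁∼F₂ b σ ∷ relabel²-map F₁ F₂ F₁∼F₂ w

  relabel-* : ∀ z w → relabel f (z *LP w) ≋ relabel f z *LP relabel f w
  relabel-* [] w = []
  relabel-* ((a , η) ∷ z) w =
    relabel-++⁺ (map _ w) (relabel-map _ _ (λ b σ → refl , ∘-homo η σ) w) (relabel-* z w)

  relabel²-⊗ : ∀ x y → relabel² f (relabel f⁻¹ x ⊗ relabel f⁻¹ y) ≋² x ⊗ y
  relabel²-⊗ [] y = []
  relabel²-⊗ ((a , η) ∷ x) y =
    relabel²-++⁺ (map _ (relabel f⁻¹ y))
      (relabel²-map _ _ (λ b σ → refl , inverseʳ η , inverseʳ σ) y) (relabel²-⊗ x y)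

  relabel²-sum² : ∀ ts → relabel² f (sum² (map (Product.map (relabel f⁻¹) (relabel f⁻¹)) ts)) ≋² sum² ts
  relabel²-sum² [] = []
  relabel²-sum² ((x , y) ∷ ts) =
    relabel²-++⁺ (relabel f⁻¹ x ⊗ relabel f⁻¹ y) (relabel²-⊗ x y) (relabel²-sum² ts)

  relabel-inverse-closed : ∀ {ℓH} {H' : Pred LP ℓH} → (∀ {z w} → z ≈LP w → H' z → H' w) →
                           ∀ {z} → H' z → H' (relabel f (relabel f⁻¹ z))
  relabel-inverse-closed H'-resp {z} = H'-resp (≋⇒≈LP-sym (relabel-inverse z))

  relabel-reflects-InH : ∀ {ℓN} {N : Pred P ℓN} z → InH N (relabel f z) → InH (λ π → N (f π)) z
  relabel-reflects-InH {N = N} z (fz∈L[N] , fz-fixed) = z∈L[N∘f] , z-fixed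
    where
    z∈L[N∘f] : InLN (λ π → N (f π)) z
    z∈L[N∘f] π π∉N∘f = trans (reflexive (≡.sym (coeff-relabel π z))) (fz∈L[N] (f π) π∉N∘f)
    z-fixed : ∀ k → (k ⋆ z) ≈LP z
    z-fixed k π = begin
      coeff π (k ⋆ z)                 ≡⟨ coeff-relabel π (k ⋆ z) ⟨
      coeff (f π) (relabel f (k ⋆ z)) ≈⟨ ≋⇒≈LP (relabel-⋆ k z) (f π) ⟩
      coeff (f π) (k ⋆ relabel f z)   ≈⟨ fz-fixed k (f π) ⟩
      coeff (f π) (relabel f z)       ≡⟨ coeff-relabel π z ⟩
      coeff π z                       ∎

  preimage-isHopfSubalgebra : ∀ {ℓN} {N : Pred P ℓN} {H' : Pred LP (c ⊔ ℓ)} → IsHopfSubalgebra N H' →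
                              IsHopfSubalgebra (λ π → N (f π)) (λ z → H' (relabel f z))
  preimage-isHopfSubalgebra {H' = H'} H'-hopf = record
    { resp      = λ {z} {w} z≈w → H.resp (relabel-resp z w z≈w)
    ; ⊆H        = λ {z} → relabel-reflects-InH z ∘ H.⊆H
    ; 0-closed  = H.0-closed
    ; +-closed  = λ {z} {w} z∈ w∈ → ≡.subst H' (≡.sym (map-++ (map₂ f) z w)) (H.+-closed z∈ w∈)
    ; K•-closed = λ {a} {z} a∈K z∈ → ≡.subst H' (≡.sym (relabel-• a z)) (H.K•-closed a∈K z∈)
    ; 1-closed  = H.resp (≋⇒≈LP ((refl , ≅-sym id-homo) ∷ [])) H.1-closed
    ; *-closed  = λ {z} {w} z∈ w∈ → H.resp (≋⇒≈LP-sym (relabel-* z w)) (H.*-closed z∈ w∈)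
    ; Δ-closed  = Δ-closed
    ; S-closed  = λ {z} z∈ → H.resp (≋⇒≈LP-sym (relabel-S z)) (H.S-closed z∈)
    }
    where
    module H = IsHopfSubalgebra H'-hopf
    φ : LP × LP → LP × LP
    φ = Product.map (relabel f⁻¹) (relabel f⁻¹)
    relabel⁻¹-closed : ∀ {z} → H' z → H' (relabel f (relabel f⁻¹ z))
    relabel⁻¹-closed = relabel-inverse-closed {H' = H'} H.resp
    Δ-closed : ∀ {z} → H' (relabel f z) → Σ (List (LP × LP)) λ ts →
               All (λ t → H' (relabel f (proj₁ t)) × H' (relabel f (proj₂ t))) ts × (Δ z ≈LP² sum² ts)
    Δ-closed {z} z∈ with H.Δ-closed z∈
    ... | ts , ts∈H' , Δfz≈ =
      map φ ts , map⁺ (All.map (Product.map relabel⁻¹-closed relabel⁻¹-closed) ts∈H') , Δz≈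
      where
      Δz≈ : Δ z ≈LP² sum² (map φ ts)
      Δz≈ π π' = begin
        coeff² π π' (Δ z)                                     ≡⟨ coeff²-relabel π π' (Δ z) ⟨
        coeff² (f π) (f π') (relabel² f (Δ z))                ≡⟨ ≡.cong (coeff² (f π) (f π')) (relabel²-Δ z) ⟩
        coeff² (f π) (f π') (Δ (relabel f z))                 ≈⟨ Δfz≈ (f π) (f π') ⟩
        coeff² (f π) (f π') (sum² ts)                         ≈⟨ ≋²⇒≈LP² (relabel²-sum² ts) (f π) (f π') ⟨
        coeff² (f π) (f π') (relabel² f (sum² (map φ ts)))    ≡⟨ coeff²-relabel π π' (sum² (map φ ts)) ⟩
        coeff² π π' (sum² (map φ ts))                         ∎

module Conjugation {c ℓ} (L : Field c ℓ) (G : FinGroup) (A : GaloisAction L G) where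
  open Field L
  open FinGroup G
  open GaloisAction A
  open Setup L G A
  open PermutationEquality G
  open FormalSums L G A
  open Perm
  open RingProperties ring using (x+x≈x⇒x≈0)
  open import Relation.Binary.Reasoning.Setoid setoid

  act-0# : ∀ g → act g 0# ≈ 0#
  act-0# g = x+x≈x⇒x≈0 _ (sym (trans (act-cong g (sym (+-identityʳ 0#))) (act-+ g 0# 0#)))

  act-by-inverse : ∀ g {h} → (g · h) ≡ e → ∀ x → act g (act h x) ≈ x
  act-by-inverse g {h} gh≡e x = begin
    act g (act h x) ≈⟨ act-hom g h x ⟨
    act (g · h) x   ≡⟨ ≡.cong (λ k → act k x) gh≡e ⟩
    act e x         ≈⟨ act-e x ⟩
    x               ∎

  act-injective : ∀ g {x y} → act g x ≈ act g y → x ≈ y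
  act-injective g {x} {y} gx≈gy = begin
    x                       ≈⟨ act-by-inverse (g ⁻¹) (inverseˡ g) x ⟨
    act (g ⁻¹) (act g x)    ≈⟨ act-cong (g ⁻¹) gx≈gy ⟩
    act (g ⁻¹) (act g y)    ≈⟨ act-by-inverse (g ⁻¹) (inverseˡ g) y ⟩
    y                       ∎

  act-ε : ∀ g z → act g (ε z) ≈ ε (g ⋆ z)
  act-ε g [] = act-0# g
  act-ε g ((a , η) ∷ z) = trans (act-+ g a (ε z)) (+-cong refl (act-ε g z))

  ε-fixed : ∀ z → (∀ g → (g ⋆ z) ≈LP z) → InK (ε z)
  ε-fixed z z-fixed g = trans (act-ε g z) (ε-resp (g ⋆ z) z (z-fixed g))

  FixedField-resp : ∀ {H' x y} → x ≈ y → FixedField H' x → FixedField H' y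
  FixedField-resp {x = x} {y} x≈y x-fixed z z∈ = begin
    z ▸ y      ≈⟨ ▸-cong z x≈y ⟨
    z ▸ x      ≈⟨ x-fixed z z∈ ⟩
    ε z * x    ≈⟨ *-cong refl x≈y ⟩
    ε z * y    ∎

  module _ (g : Fin order) where
    private
      ρ̂ : P → P
      ρ̂ = conjρ⁻¹ G g

    open Relabelling L G A (conjρ⁻¹-isλEquivariantAutomorphism g)

    ⋆-relabel-▸ : ∀ w x → (((g ⁻¹) ⋆ relabel ρ̂ w) ▸ x) ≈ act (g ⁻¹) (w ▸ act g x)
    ⋆-relabel-▸ [] x = sym (act-0# (g ⁻¹))
    ⋆-relabel-▸ ((a , π) ∷ w) x = begin
      act (g ⁻¹) a * act (inv (conjλ G (g ⁻¹) (ρ̂ π)) e) x + ((g ⁻¹) ⋆ relabel ρ̂ w) ▸ x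
        ≈⟨ +-cong (*-cong refl evaluation) (⋆-relabel-▸ w x) ⟩
      act (g ⁻¹) a * act (g ⁻¹) (act (inv π e) (act g x)) + act (g ⁻¹) (w ▸ act g x)
        ≈⟨ +-cong (act-* (g ⁻¹) _ _) refl ⟨
      act (g ⁻¹) (a * act (inv π e) (act g x)) + act (g ⁻¹) (w ▸ act g x)
        ≈⟨ act-+ (g ⁻¹) _ _ ⟨
      act (g ⁻¹) (a * act (inv π e) (act g x) + w ▸ act g x) ∎
      where
      -- the inverse of λ(g⁻¹) ρ̂(π) λ(g) sends e to g⁻¹ π⁻¹[e] g
      evaluation : act (inv (conjλ G (g ⁻¹) (ρ̂ π)) e) x ≈ act (g ⁻¹) (act (inv π e) (act g x))
      evaluation = begin
        act (g ⁻¹ · (inv π (((g ⁻¹) ⁻¹ · e) · g ⁻¹) · g)) x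
          ≡⟨ ≡.cong (λ u → act (g ⁻¹ · (inv π u · g)) x)
                    (≡.trans (≡.cong (_· g ⁻¹) (identityʳ _)) (inverseˡ (g ⁻¹))) ⟩
        act (g ⁻¹ · (inv π e · g)) x              ≈⟨ act-hom _ _ x ⟩
        act (g ⁻¹) (act (inv π e · g) x)          ≈⟨ act-cong (g ⁻¹) (act-hom _ _ x) ⟩
        act (g ⁻¹) (act (inv π e) (act g x))      ∎

    act-▸-relabel : ∀ w x → (∀ k → (k ⋆ relabel ρ̂ w) ≈LP relabel ρ̂ w) →
                    act g (relabel ρ̂ w ▸ x) ≈ (w ▸ act g x)
    act-▸-relabel w x ρ̂w-fixed = begin
      act g (relabel ρ̂ w ▸ x)
        ≈⟨ act-cong g (▸-resp (relabel ρ̂ w) ((g ⁻¹) ⋆ relabel ρ̂ w) x λ η → sym (ρ̂w-fixed (g ⁻¹) η)) ⟩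
      act g (((g ⁻¹) ⋆ relabel ρ̂ w) ▸ x)  ≈⟨ act-cong g (⋆-relabel-▸ w x) ⟩
      act g (act (g ⁻¹) (w ▸ act g x))    ≈⟨ act-by-inverse g (inverseʳ g) _ ⟩
      w ▸ act g x                         ∎

    module _ {ℓN} {N : Pred P ℓN} {H' : Pred LP (c ⊔ ℓ)} (H'-hopf : IsHopfSubalgebra N H') where
      private
        module H = IsHopfSubalgebra H'-hopf

      fixedField-act : ∀ x → FixedField H' x → FixedField (λ w → H' (relabel ρ̂ w)) (act g x)
      fixedField-act x x-fixed w ρ̂w∈H' = begin
        w ▸ act g x                        ≈⟨ act-▸-relabel w x ρ̂w-fixed ⟨
        act g (relabel ρ̂ w ▸ x)            ≈⟨ act-cong g (x-fixed _ ρ̂w∈H') ⟩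
        act g (ε (relabel ρ̂ w) * x)        ≈⟨ act-* g _ _ ⟩
        act g (ε (relabel ρ̂ w)) * act g x  ≈⟨ *-cong (ε-fixed (relabel ρ̂ w) ρ̂w-fixed g) refl ⟩
        ε (relabel ρ̂ w) * act g x          ≡⟨ ≡.cong (_* act g x) (ε-relabel ρ̂ w) ⟩
        ε w * act g x                      ∎
        where
        ρ̂w-fixed : ∀ k → (k ⋆ relabel ρ̂ w) ≈LP relabel ρ̂ w
        ρ̂w-fixed = proj₂ (H.⊆H ρ̂w∈H')

      fixedField-act⁻¹ : ∀ x → FixedField (λ w → H' (relabel ρ̂ w)) (act g x) → FixedField H' x
      fixedField-act⁻¹ x gx-fixed z z∈H' = begin
        z ▸ x                    ≈⟨ ▸-resp z (relabel ρ̂ w) x (≋⇒≈LP-sym (relabel-inverse z)) ⟩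
        relabel ρ̂ w ▸ x          ≈⟨ act-injective g g-both-sides ⟩
        ε (relabel ρ̂ w) * x      ≈⟨ *-cong (ε-resp (relabel ρ̂ w) z (≋⇒≈LP (relabel-inverse z))) refl ⟩
        ε z * x                  ∎
        where
        w : LP
        w = relabel (conjρ⁻¹ G (g ⁻¹)) z
        ρ̂w∈H' : H' (relabel ρ̂ w)
        ρ̂w∈H' = relabel-inverse-closed {H' = H'} H.resp z∈H'
        ρ̂w-fixed : ∀ k → (k ⋆ relabel ρ̂ w) ≈LP relabel ρ̂ w
        ρ̂w-fixed = proj₂ (H.⊆H ρ̂w∈H')
        g-both-sides : act g (relabel ρ̂ w ▸ x) ≈ act g (ε (relabel ρ̂ w) * x)
        g-both-sides = begin
          act g (relabel ρ̂ w ▸ x)            ≈⟨ act-▸-relabel w x ρ̂w-fixed ⟩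
          w ▸ act g x                        ≈⟨ gx-fixed w ρ̂w∈H' ⟩
          ε w * act g x                      ≡⟨ ≡.cong (_* act g x) (ε-relabel ρ̂ w) ⟨
          ε (relabel ρ̂ w) * act g x          ≈⟨ *-cong (ε-fixed (relabel ρ̂ w) ρ̂w-fixed g) refl ⟨
          act g (ε (relabel ρ̂ w)) * act g x  ≈⟨ act-* g _ _ ⟨
          act g (ε (relabel ρ̂ w) * x)        ∎

    realizable-image : ∀ {ℓN ℓM} {N : Pred P ℓN} {M : Pred Carrier ℓM} →
                       Realizable N M → Realizable (conjSub G g N) (image g M)
    realizable-image {M = M} (H' , H'-hopf , H'-realizes) =
      (λ w → H' (relabel ρ̂ w)) , preimage-isHopfSubalgebra H'-hopf , λ y → into y , out y
      where
      into : ∀ y → image g M y → FixedField (λ w → H' (relabel ρ̂ w)) y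
      into y (x , x∈M , y≈gx) =
        FixedField-resp (sym y≈gx) (fixedField-act H'-hopf x (proj₁ (H'-realizes x) x∈M))
      out : ∀ y → FixedField (λ w → H' (relabel ρ̂ w)) y → image g M y
      out y y-fixed with act-surj g y
      ... | x , gx≈y =
        x , proj₂ (H'-realizes x) (fixedField-act⁻¹ H'-hopf x (FixedField-resp (sym gx≈y) y-fixed)) , sym gx≈y

  isHopfSubalgebra-mono : ∀ {ℓN ℓN'} {N : Pred P ℓN} {N' : Pred P ℓN'} {H' : Pred LP (c ⊔ ℓ)} →
                          N ⊆ N' → IsHopfSubalgebra N H' → IsHopfSubalgebra N' H'
  isHopfSubalgebra-mono N⊆N' H'-hopf = record
    { resp      = H.resp
    ; ⊆H        = map₁ (λ z∈L[N] η η∉N' → z∈L[N] η (η∉N' ∘ N⊆N')) ∘ H.⊆H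
    ; 0-closed  = H.0-closed
    ; +-closed  = H.+-closed
    ; K•-closed = H.K•-closed
    ; 1-closed  = H.1-closed
    ; *-closed  = H.*-closed
    ; Δ-closed  = H.Δ-closed
    ; S-closed  = H.S-closed
    }
    where module H = IsHopfSubalgebra H'-hopf

  realizable-mono : ∀ {ℓN ℓN' ℓM} {N : Pred P ℓN} {N' : Pred P ℓN'} {M : Pred Carrier ℓM} →
                    N ⊆ N' → Realizable N M → Realizable N' M
  realizable-mono N⊆N' (H' , H'-hopf , H'-realizes) = H' , isHopfSubalgebra-mono N⊆N' H'-hopf , H'-realizes

  realizable-resp : ∀ {ℓN ℓM ℓM'} {N : Pred P ℓN} {M : Pred Carrier ℓM} {M' : Pred Carrier ℓM'} →
                    M ⊆ M' → M' ⊆ M → Realizable N M → Realizable N M'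
  realizable-resp M⊆M' M'⊆M (H' , H'-hopf , H'-realizes) =
    H' , H'-hopf , λ x → proj₁ (H'-realizes x) ∘ M'⊆M , M⊆M' ∘ proj₂ (H'-realizes x)

  image-image⁻¹ : ∀ {ℓM} {M : Pred Carrier ℓM} → (∀ {x y} → x ≈ y → M x → M y) →
                  ∀ g → image (g ⁻¹) (image g M) ⊆ M
  image-image⁻¹ M-resp g (_ , (x , x∈M , x'≈gx) , y≈g⁻¹x') =
    M-resp (sym (trans y≈g⁻¹x' (trans (act-cong (g ⁻¹) x'≈gx) (act-by-inverse (g ⁻¹) (inverseˡ g) x)))) x∈M

  ⊆-image-image⁻¹ : ∀ {ℓM} {M : Pred Carrier ℓM} g → M ⊆ image (g ⁻¹) (image g M)
  ⊆-image-image⁻¹ g {x} x∈M = act g x , (x , x∈M , refl) , sym (act-by-inverse (g ⁻¹) (inverseˡ g) x)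

  realizable-image⁻¹ : ∀ {ℓN ℓM} {N : Pred P ℓN} {M : Pred Carrier ℓM} →
                       (∀ {π σ} → _≐_ G π σ → N π → N σ) → (∀ {x y} → x ≈ y → M x → M y) →
                       ∀ g → Realizable (conjSub G g N) (image g M) → Realizable N M
  realizable-image⁻¹ N-resp M-resp g =
    realizable-resp (image-image⁻¹ M-resp g) (⊆-image-image⁻¹ g)
    ∘ realizable-mono (λ {π} → N-resp (pointwise (conjρ⁻¹-inverseʳ g π)))
    ∘ realizable-image (g ⁻¹)

theorem3p2 : ∀ {c ℓ ℓN ℓM : Level} (L : Field c ℓ) (G : FinGroup) (A : GaloisAction L G)
    (N : Pred (Perm G) ℓN) → IsRegularSubgroup G N → IsGStable G N →
    (g : Fin (FinGroup.order G)) →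
    (M : Pred (Field.Carrier L) ℓM) → Setup.IsIntermediate L G A M →
    Setup.Realizable L G A N M ⇔ Setup.Realizable L G A (conjSub G g N) (Setup.image L G A g M)
theorem3p2 L G A N N-regular _ g M M-intermediate =
  mk⇔ (realizable-image g)
      (realizable-image⁻¹ (IsSubgroup.resp (IsRegularSubgroup.isSubgroup N-regular))
                          (Setup.IsIntermediate.resp M-intermediate) g)
  where open Conjugation L G A
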